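{- Let $D:\mathcal{U}$ and $R:D\to D\to\mathcal{U}$, and let $\mathsf{quot}\,D\,R$ and $\mathsf{cls}:D\to\mathsf{quot}\,D\,R$ be as in the context. Then for all $x,y:D$, $R\,x\,y \to \mathsf{cls}\,x = \mathsf{cls}\,y$.
   Context: Type theory: intensional Martin-Löf type theory with universes $\mathcal{U}:\mathcal{U}_0:\cdots$, bottom universe $\mathcal{U}$ impredicative (if $A$ is a type in any universe and $a:A\vdash B:\mathcal{U}$ then $\prod_{a:A}B:\mathcal{U}$), universes closed under $\Sigma$ and identity types; $\pi_1,\pi_2$ projections, $f\circ g := \lambda x.f(g\,x)$. Axioms: function extensionality and UIP. For $f:D\to C$: $\mathsf{EqCls}\,f\,R := \prod_{x,y:D} R\,x\,y\to f\,x=f\,y$. Impredicative quotient: $\mathsf{quot}^*\,D\,R := \prod_{C:\mathcal{U}}\prod_{f:D\to C}\mathsf{EqCls}\,f\,R\to C$; $\mathsf{cls}^*\,d := \lambda C\,f\,H.\ f\,d$; $\mathsf{rec}^*\,C\,f\,H\,q := q\,C\,f\,H$. For $q:\mathsf{quot}^*\,D\,R$: $\mathsf{LimQuot}\,q := \prod_{X,Y:\mathcal{U}}\prod_{g:D\to X}\prod_{g':D\to Y}\prod_{f:X\to Y}\prod_{H:\mathsf{EqCls}\,g\,R}\prod_{H':\mathsf{EqCls}\,g'\,R} (f\circ g = g') \to f(\mathsf{rec}^*\,X\,g\,H\,q) = \mathsf{rec}^*\,Y\,g'\,H'\,q$. Define $\mathsf{quot}\,D\,R := \sum_{q:\mathsf{quot}^*\,D\,R}\mathsf{LimQuot}\,q$.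 There is a proof $p:\prod_{d:D}\mathsf{LimQuot}(\mathsf{cls}^*\,d)$; set $\mathsf{cls}\,d := \langle \mathsf{cls}^*\,d, p\,d\rangle$. -}

module Defs where

open import Level using (Level; _⊔_; 0ℓ) renaming (suc to lsuc)
open import Data.Product using (Σ; _,_; proj₁; proj₂)
open import Relation.Binary.PropositionalEquality using (_≡_; refl; cong-app)
open import Function using (_∘_)

EqCls : {D C : Set} → (D → C) → (D → D → Set) → Set
EqCls {D} f R = (x y : D) → R x y → f x ≡ f y

-- Impredicative quotient (predicatively it lives in Set₁)
quot* : (D : Set) → (D → D → Set) → Set₁
quot* D R = (C : Set) (f : D → C) → EqCls f R → C

cls* : {D : Set} {R : D → D → Set} → D → quot* D R
cls* d = λ C f H → f d

rec* : {D : Set} {R : D → D → Set} (C : Set) (f : D → C) → EqCls f R → quot* D R → C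
rec* C f H q = q C f H

LimQuot : {D : Set} {R : D → D → Set} → quot* D R → Set₁
LimQuot {D} {R} q =
  (X Y : Set) (g : D → X) (g' : D → Y) (f : X → Y)
  (H : EqCls g R) (H' : EqCls g' R) →
  (f ∘ g) ≡ g' → f (rec* X g H q) ≡ rec* Y g' H' q

quot : (D : Set) → (D → D → Set) → Set₁
quot D R = Σ (quot* D R) LimQuot

p : {D : Set} {R : D → D → Set} (d : D) → LimQuot {D} {R} (cls* d)
p d X Y g g' f H H' e = cong-app e d

cls : {D : Set} {R : D → D → Set} → D → quot D R
cls {D} {R} d = cls* {D} {R} d , p {D} {R} d

{-# OPTIONS --safe #-}
module Submission where

open import Defs
open import Data.Product using (_,_; proj₁)
open import Data.Product.Properties using (Σ-≡,≡→≡)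
open import Relation.Binary.PropositionalEquality using (_≡_)
open import Relation.Nullary using (Irrelevant)
open import Axiom.Extensionality.Propositional using (Extensionality)
open import Axiom.UniquenessOfIdentityProofs using (UIP)

module _ (funext : ∀ {a b} → Extensionality a b) {D : Set} {R : D → D → Set} where

  cls*-respects : ∀ {x y} → R x y → cls* {D} {R} x ≡ cls* y
  cls*-respects {x} {y} r = funext λ C → funext λ f → funext λ H → H x y r

  module _ (uip : ∀ {A : Set} → UIP A) where

    LimQuot-irrelevant : (q : quot* D R) → Irrelevant (LimQuot q)
    LimQuot-irrelevant q l l′ =
      funext λ X → funext λ Y → funext λ g → funext λ g′ →
      funext λ f → funext λ H → funext λ H′ → funext λ e → uip (l X Y g g′ f H H′ e) _

    quot-≡ : {q q′ : quot D R} → proj₁ q ≡ proj₁ q′ → q ≡ q′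
    quot-≡ {q′ = q′} e = Σ-≡,≡→≡ (e , LimQuot-irrelevant (proj₁ q′) _ _)

lemma5p3p4 : (funext : ∀ {a b} → Extensionality a b)
             (uip : ∀ {a} {A : Set a} → UIP A)
             (D : Set) (R : D → D → Set) (x y : D) →
             R x y → cls {D} {R} x ≡ cls {D} {R} y
lemma5p3p4 funext uip D R x y r = quot-≡ funext uip (cls*-respects funext r)
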